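{- (a) Let $M$ be an $N\times N$ skew-symmetric matrix with $M_{ij}\ge 0$ whenever $i\ge j$. Then $\tau M\tau^{ -1}$ has the same property. (b) Every period $2$ primitive $B_{N,2}^{(k,l)}$ has nonnegative entries below the leading diagonal.
   Context: $\tau$ is the $N\times N$ matrix with $\tau_{i+1,i}=1$ ($1\le i\le N-1$), $\tau_{1,N}=-1$, other entries $0$. Let $N=2r$. For $1\le k\le r$, $R_N^{(k)}$ is the skew-symmetric matrix with $(R_N^{(k)})_{N-k+1,1}=1$, $(R_N^{(k)})_{1,N-k+1}=-1$, all other entries $0$. The period $2$ primitives are: for $1\le k\le r-1$, $B_{N,2}^{(k,1)}=\sum_{i=0}^{r-1}\tau^{2i}R_N^{(k)}\tau^{ -2i}$; if $4\mid N$, $B_{N,2}^{(r,1)}=\sum_{i=0}^{r/2-1}\tau^{2i}R_N^{(r)}\tau^{ -2i}$; and in each case $B_{N,2}^{(k,2)}=\tau B_{N,2}^{(k,1)}\tau^{ -1}$. -}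

module Defs where

open import Data.Nat as ℕ using (ℕ; zero; suc; _∸_)
open import Data.Fin using (Fin; toℕ)
import Data.Fin as F
open import Data.Integer using (ℤ; 0ℤ; 1ℤ; -1ℤ; _+_; _*_; -_; _≤_; _<_; +_)
open import Data.Bool using (Bool; true; false; if_then_else_; _∧_)
open import Relation.Nullary.Decidable using (⌊_⌋)
open import Relation.Binary.PropositionalEquality using (_≡_)

-- N × N integer matrices, indices 0-based (paper index p corresponds to Fin index p-1).
Mat : ℕ → Set
Mat N = Fin N → Fin N → ℤ

ΣFin : ∀ {n} → (Fin n → ℤ) → ℤ
ΣFin {zero} f = 0ℤ
ΣFin {suc n} f = f F.zero + ΣFin (λ i → f (F.suc i))

_·_ : ∀ {N} → Mat N → Mat N → Mat N
(A · B) i j = ΣFin (λ k → A i k * B k j)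

_⊕_ : ∀ {N} → Mat N → Mat N → Mat N
(A ⊕ B) i j = A i j + B i j

zeroM : ∀ {N} → Mat N
zeroM i j = 0ℤ

ΣMat : ∀ {N} → ℕ → (ℕ → Mat N) → Mat N
ΣMat zero f = zeroM
ΣMat (suc m) f = ΣMat m f ⊕ f m

_==_ : ℕ → ℕ → Bool
a == b = ⌊ a ℕ.≟ b ⌋

-- τ : τ_{i+1,i} = 1 (1 ≤ i ≤ N-1), τ_{1,N} = -1 (paper's 1-based indices)
τ : ∀ {N} → Mat N
τ {N} i j =
  if toℕ i == suc (toℕ j) then 1ℤ
  else if (toℕ i == 0) ∧ (toℕ j == (N ∸ 1)) then -1ℤ
  else 0ℤ

-- τ⁻¹, written out explicitly: τ is a signed permutation matrix, so τ⁻¹ = τᵀ,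
-- i.e. (τ⁻¹)_{i,i+1} = 1, (τ⁻¹)_{N,1} = -1.
τ⁻¹ : ∀ {N} → Mat N
τ⁻¹ i j = τ j i

conjτ : ∀ {N} → ℕ → Mat N → Mat N
conjτ zero M = M
conjτ (suc m) M = (τ · conjτ m M) · τ⁻¹

SkewSymmetric : ∀ {N} → Mat N → Set
SkewSymmetric M = ∀ i j → M i j ≡ - M j i

NonnegOnAndBelowDiag : ∀ {N} → Mat N → Set
NonnegOnAndBelowDiag M = ∀ i j → toℕ j ℕ.≤ toℕ i → 0ℤ ≤ M i j

NonnegBelowDiag : ∀ {N} → Mat N → Set
NonnegBelowDiag M = ∀ i j → toℕ j ℕ.< toℕ i → 0ℤ ≤ M i j

-- R_N^{(k)}: (N-k+1, 1) entry 1, (1, N-k+1) entry -1 (1-based)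
R : (N k : ℕ) → Mat N
R N k i j =
  if (toℕ i == (N ∸ k)) ∧ (toℕ j == 0) then 1ℤ
  else if (toℕ i == 0) ∧ (toℕ j == (N ∸ k)) then -1ℤ
  else 0ℤ

Bsum : (N m k : ℕ) → Mat N
Bsum N m k = ΣMat m (λ i → conjτ (2 ℕ.* i) (R N k))

-- B_{N,2}^{(k,1)} for 1 ≤ k ≤ r-1, N = 2r
B1 : (r k : ℕ) → Mat (2 ℕ.* r)
B1 r k = Bsum (2 ℕ.* r) r k

-- B_{N,2}^{(r,1)} for N = 2r, 4 ∣ N
B1top : (r : ℕ) → Mat (2 ℕ.* r)
B1top r = Bsum (2 ℕ.* r) (r ℕ./ 2) r

B2 : ∀ {N} → Mat N → Mat N
B2 B = conjτ 1 B

-- τ is a signed cyclic shift: conjugating by it moves the entry (i, j) to (i+1, j+1),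
-- except that an index wrapping around from N to 1 picks up a sign −1. For a
-- skew-symmetric M, an entry (i, N) that wraps to (i+1, 1) becomes −M(i, N) = M(N, i),
-- which lies below the diagonal; entries that do not wrap keep their position relative
-- to the diagonal. So "skew-symmetric and nonnegative on and below the diagonal" is
-- preserved by conjugation by τ, and also by sums. Every period 2 primitive is a sum of
-- conjugates of some R_N^{(k)}, which has this property as soon as k < N.
module Submission where

open import Defs
open import Data.Nat using (ℕ; _≤_; _*_; _∸_)
open import Data.Nat.Divisibility using (_∣_)
open import Data.Product using (_×_)

open import Data.Nat as ℕ using (zero; suc; _<_; s≤s; z≤n; z<s)
import Data.Nat.Properties as ℕP
open import Data.Product using (_,_; proj₁; proj₂)
open import Data.Fin using (Fin; toℕ; zero; suc; fromℕ; inject₁)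
open import Data.Fin.Properties as FinP using (toℕ-fromℕ; toℕ-inject₁; toℕ-injective; toℕ<n)
open import Data.Bool using (if_then_else_; _∧_)
open import Function using (_∘_)
open import Data.Integer as ℤ using (ℤ; 0ℤ; 1ℤ; -1ℤ; -_; +≤+)
import Data.Integer.Properties as ℤP
open import Data.Integer.Tactic.RingSolver using (solve-∀)
open import Relation.Nullary using (yes; no; contradiction)
open import Relation.Binary.PropositionalEquality

ΣFin-zero : ∀ {n} (h : Fin n → ℤ) → (∀ k → h k ≡ 0ℤ) → ΣFin h ≡ 0ℤ
ΣFin-zero {zero}  h h≡0 = refl
ΣFin-zero {suc n} h h≡0
  rewrite h≡0 zero | ΣFin-zero (λ k → h (suc k)) (λ k → h≡0 (suc k)) = refl

ΣFin-single : ∀ {n} (h : Fin n → ℤ) (p : Fin n) →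
              (∀ k → k ≢ p → h k ≡ 0ℤ) → ΣFin h ≡ h p
ΣFin-single h zero h≡0
  rewrite ΣFin-zero (λ k → h (suc k)) (λ k → h≡0 (suc k) (λ ())) = ℤP.+-identityʳ (h zero)
ΣFin-single h (suc p) h≡0 rewrite h≡0 zero (λ ()) =
  trans (ℤP.+-identityˡ _)
        (ΣFin-single (λ k → h (suc k)) p (λ k k≢p → h≡0 (suc k) (k≢p ∘ FinP.suc-injective)))

-- Row i of τ has its single nonzero entry τ-sign i in column τ-col i.
τ-col : ∀ {n} → Fin (suc n) → Fin (suc n)
τ-col {n} zero = fromℕ n
τ-col (suc i) = inject₁ i

τ-sign : ∀ {n} → Fin (suc n) → ℤ
τ-sign zero = -1ℤ
τ-sign (suc i) = 1ℤ

τ-offCol : ∀ {n} (i k : Fin (suc n)) → k ≢ τ-col i → τ i k ≡ 0ℤ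
τ-offCol {n} zero k k≢ with toℕ k ℕ.≟ n
... | yes k≡n = contradiction (toℕ-injective (trans k≡n (sym (toℕ-fromℕ n)))) k≢
... | no _    = refl
τ-offCol (suc i) k k≢ with suc (toℕ i) ℕ.≟ suc (toℕ k)
... | yes i≡k = contradiction (toℕ-injective (trans (sym (ℕP.suc-injective i≡k)) (sym (toℕ-inject₁ i)))) k≢
... | no _    = refl

τ-onCol : ∀ {n} (i : Fin (suc n)) → τ i (τ-col i) ≡ τ-sign i
τ-onCol {n} zero rewrite toℕ-fromℕ n with n ℕ.≟ n
... | yes _   = refl
... | no n≢n  = contradiction refl n≢n
τ-onCol (suc i) rewrite toℕ-inject₁ i with suc (toℕ i) ℕ.≟ suc (toℕ i)
... | yes _   = refl
... | no i≢i  = contradiction refl i≢i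

τ·-entry : ∀ {n} (M : Mat (suc n)) i l → (τ · M) i l ≡ τ-sign i ℤ.* M (τ-col i) l
τ·-entry M i l =
  trans (ΣFin-single (λ k → τ i k ℤ.* M k l) (τ-col i)
                     (λ k k≢ → cong (ℤ._* M k l) (τ-offCol i k k≢)))
        (cong (ℤ._* M (τ-col i) l) (τ-onCol i))

conjτ-entry : ∀ {n} (M : Mat (suc n)) i j →
              conjτ 1 M i j ≡ (τ-sign i ℤ.* M (τ-col i) (τ-col j)) ℤ.* τ-sign j
conjτ-entry M i j =
  trans (ΣFin-single (λ l → (τ · M) i l ℤ.* τ j l) (τ-col j)
                     (λ l l≢ → trans (cong ((τ · M) i l ℤ.*_) (τ-offCol j l l≢)) (ℤP.*-zeroʳ ((τ · M) i l))))
        (cong₂ ℤ._*_ (τ·-entry M i (τ-col j)) (τ-onCol j))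

conjτ-skew : ∀ {N} {M : Mat N} → SkewSymmetric M → SkewSymmetric (conjτ 1 M)
conjτ-skew {zero} skew ()
conjτ-skew {suc n} {M} skew i j
  rewrite conjτ-entry M i j | conjτ-entry M j i | skew (τ-col i) (τ-col j) =
  signs-swap (τ-sign i) (M (τ-col j) (τ-col i)) (τ-sign j)
  where
  signs-swap : ∀ a y b → (a ℤ.* (- y)) ℤ.* b ≡ - ((b ℤ.* y) ℤ.* a)
  signs-swap = solve-∀

conjτ-nonnegOnAndBelowDiag : ∀ {N} {M : Mat N} → SkewSymmetric M →
  NonnegOnAndBelowDiag M → NonnegOnAndBelowDiag (conjτ 1 M)
conjτ-nonnegOnAndBelowDiag {zero} skew nonneg ()
conjτ-nonnegOnAndBelowDiag {suc n} {M} skew nonneg i j j≤i =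
  subst (0ℤ ℤ.≤_) (sym (conjτ-entry M i j)) (signed i j j≤i)
  where
  wrap-both : ∀ x → (-1ℤ ℤ.* x) ℤ.* -1ℤ ≡ x
  wrap-both = solve-∀
  wrap-column : ∀ x → (1ℤ ℤ.* (- x)) ℤ.* -1ℤ ≡ x
  wrap-column = solve-∀
  wrap-none : ∀ x → (1ℤ ℤ.* x) ℤ.* 1ℤ ≡ x
  wrap-none = solve-∀
  inject₁≤last : ∀ (i : Fin n) → toℕ (inject₁ i) ≤ toℕ (fromℕ n)
  inject₁≤last i rewrite toℕ-inject₁ i | toℕ-fromℕ n = ℕP.<⇒≤ (toℕ<n i)

  signed : ∀ i j → toℕ j ≤ toℕ i →
           0ℤ ℤ.≤ (τ-sign i ℤ.* M (τ-col i) (τ-col j)) ℤ.* τ-sign j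
  signed zero    zero    _ =
    subst (0ℤ ℤ.≤_) (sym (wrap-both _)) (nonneg (fromℕ n) (fromℕ n) ℕP.≤-refl)
  signed (suc i) zero    _ rewrite skew (inject₁ i) (fromℕ n) =
    subst (0ℤ ℤ.≤_) (sym (wrap-column _)) (nonneg (fromℕ n) (inject₁ i) (inject₁≤last i))
  signed (suc i) (suc j) (s≤s j≤i) =
    subst (0ℤ ℤ.≤_) (sym (wrap-none _))
      (nonneg (inject₁ i) (inject₁ j) (subst₂ _≤_ (sym (toℕ-inject₁ j)) (sym (toℕ-inject₁ i)) j≤i))

NonnegSkew : ∀ {N} → Mat N → Set
NonnegSkew M = SkewSymmetric M × NonnegOnAndBelowDiag M

conjτ-nonnegSkew : ∀ {N} {M : Mat N} → NonnegSkew M → NonnegSkew (conjτ 1 M)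
conjτ-nonnegSkew (skew , nonneg) = conjτ-skew skew , conjτ-nonnegOnAndBelowDiag skew nonneg

conjτⁿ-nonnegSkew : ∀ {N} m {M : Mat N} → NonnegSkew M → NonnegSkew (conjτ m M)
conjτⁿ-nonnegSkew zero    hM = hM
conjτⁿ-nonnegSkew (suc m) hM = conjτ-nonnegSkew (conjτⁿ-nonnegSkew m hM)

ΣMat-nonnegSkew : ∀ {N} m (f : ℕ → Mat N) → (∀ i → NonnegSkew (f i)) → NonnegSkew (ΣMat m f)
ΣMat-nonnegSkew zero    f hf = (λ i j → refl) , (λ i j _ → +≤+ z≤n)
ΣMat-nonnegSkew (suc m) f hf = skew , nonneg
  where
  hΣ = ΣMat-nonnegSkew m f hf
  skew : SkewSymmetric (ΣMat (suc m) f)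
  skew i j rewrite proj₁ hΣ i j | proj₁ (hf m) i j =
    sym (ℤP.neg-distrib-+ (ΣMat m f j i) (f m j i))
  nonneg : NonnegOnAndBelowDiag (ΣMat (suc m) f)
  nonneg i j j≤i = ℤP.+-mono-≤ (proj₂ hΣ i j j≤i) (proj₂ (hf m) i j j≤i)

-- R N k i j is definitionally rEntry (toℕ i) (toℕ j) (N ∸ k).
rEntry : ℕ → ℕ → ℕ → ℤ
rEntry a b c = if (a == c) ∧ (b == 0) then 1ℤ else if (a == 0) ∧ (b == c) then -1ℤ else 0ℤ

rEntry-skew : ∀ a b c → c ≢ 0 → rEntry a b c ≡ - rEntry b a c
rEntry-skew a       b       zero    c≢0 = contradiction refl c≢0
rEntry-skew zero    zero    (suc c) _ = refl
rEntry-skew zero    (suc b) (suc c) _ with suc b ℕ.≟ suc c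
... | yes _ = refl
... | no _  = refl
rEntry-skew (suc a) zero    (suc c) _ with suc a ℕ.≟ suc c
... | yes _ = refl
... | no _  = refl
rEntry-skew (suc a) (suc b) (suc c) _ with suc a ℕ.≟ suc c | suc b ℕ.≟ suc c
... | yes _ | yes _ = refl
... | yes _ | no _  = refl
... | no _  | yes _ = refl
... | no _  | no _  = refl

rEntry-nonneg : ∀ a b c → c ≢ 0 → b ≤ a → 0ℤ ℤ.≤ rEntry a b c
rEntry-nonneg a       b       zero    c≢0 _ = contradiction refl c≢0
rEntry-nonneg zero    zero    (suc c) _ _ = +≤+ z≤n
rEntry-nonneg (suc a) zero    (suc c) _ _ with suc a ℕ.≟ suc c
... | yes _ = +≤+ z≤n
... | no _  = +≤+ z≤n
rEntry-nonneg (suc a) (suc b) (suc c) _ _ with suc a ℕ.≟ suc c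
... | yes _ = +≤+ z≤n
... | no _  = +≤+ z≤n

R-nonnegSkew : ∀ {N k} → k < N → NonnegSkew (R N k)
R-nonnegSkew {N} {k} k<N =
  (λ i j → rEntry-skew (toℕ i) (toℕ j) (N ∸ k) N∸k≢0) ,
  (λ i j j≤i → rEntry-nonneg (toℕ i) (toℕ j) (N ∸ k) N∸k≢0 j≤i)
  where
  N∸k≢0 : N ∸ k ≢ 0
  N∸k≢0 = ℕP.m<n⇒n≢0 (ℕP.m<n⇒0<n∸m k<N)

Bsum-nonnegSkew : ∀ {N} m {k} → k < N → NonnegSkew (Bsum N m k)
Bsum-nonnegSkew m k<N =
  ΣMat-nonnegSkew m _ (λ i → conjτⁿ-nonnegSkew (2 * i) (R-nonnegSkew k<N))

Bsum-double-nonnegSkew : ∀ r m {k} → k ≤ r → NonnegSkew (Bsum (2 * r) m k)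
Bsum-double-nonnegSkew zero    m k≤r = (λ ()) , (λ ())
Bsum-double-nonnegSkew (suc r) m k≤r =
  Bsum-nonnegSkew m (ℕP.≤-<-trans k≤r (ℕP.m<m+n (suc r) z<s))

primitive-nonnegBelowDiag : ∀ {N} {B : Mat N} → NonnegSkew B →
  NonnegBelowDiag B × NonnegBelowDiag (B2 B)
primitive-nonnegBelowDiag hB =
  strictly (proj₂ hB) , strictly (proj₂ (conjτ-nonnegSkew hB))
  where
  strictly : ∀ {N} {M : Mat N} → NonnegOnAndBelowDiag M → NonnegBelowDiag M
  strictly nonneg i j j<i = nonneg i j (ℕP.<⇒≤ j<i)

-- The hypotheses 1 ≤ k and 4 ∣ N only delimit the paper's range of primitives;
-- the bound k ≤ r is all that is needed.
mainTheorem5 :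
    (∀ (N : ℕ) (M : Mat N) → SkewSymmetric M → NonnegOnAndBelowDiag M →
      NonnegOnAndBelowDiag (conjτ 1 M))
    × ((∀ (r k : ℕ) → 1 ≤ k → k ≤ r ∸ 1 →
          NonnegBelowDiag (B1 r k) × NonnegBelowDiag (B2 (B1 r k)))
       × (∀ (r : ℕ) → 4 ∣ 2 * r →
          NonnegBelowDiag (B1top r) × NonnegBelowDiag (B2 (B1top r))))
mainTheorem5 =
  (λ N M → conjτ-nonnegOnAndBelowDiag) ,
  (λ r k _ k≤r∸1 → primitive-nonnegBelowDiag
                     (Bsum-double-nonnegSkew r r (ℕP.≤-trans k≤r∸1 (ℕP.m∸n≤m r 1)))) ,
  (λ r _ → primitive-nonnegBelowDiag (Bsum-double-nonnegSkew r (r ℕ./ 2) ℕP.≤-refl))
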